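{- Let $p$ be an odd prime and let $\alpha \in \mathbb{Q}_p$ have infinite $p$-adic continued fraction expansion $\alpha = [0, b_1, b_2, \ldots]$ (of Browkin type or of Ruban type), with convergents $A_n/B_n$. Suppose the sequence $(b_n)_{n \ge 1}$ begins with arbitrarily long palindromes, i.e. for infinitely many $n$ one has $b_j = b_{n+1-j}$ for all $1 \le j \le n$. Then for infinitely many $n$, \[ \left| \alpha^2 - \frac{A_{n-1}}{B_n} \right|_p < \frac{|b_1|_p}{|B_n|_p^2}. \]
   Context: $|\cdot|_p$ is the $p$-adic absolute value. $p$-adic continued fractions: write $\beta = \sum_{i \ge r} a_i p^i \in \mathbb{Q}_p$ with digits $a_i \in \{ -\tfrac{p-1}{2}, \ldots, \tfrac{p-1}{2}\}$ (Browkin) or $a_i \in \{0, \ldots, p-1\}$ (Ruban), and set $s(\beta) = \sum_{i=r}^{0} a_i p^i$. For $\alpha_0 = \alpha$: $b_i = s(\alpha_i)$, $\alpha_{i+1} = 1/(\alpha_i - b_i)$. Convergents: $A_{ -2}=0$, $A_{ -1}=1$, $A_i = b_i A_{i-1} + A_{i-2}$; $B_{ -2}=1$, $B_{ -1}=0$, $B_i = b_i B_{i-1} + B_{i-2}$ for $i \ge 0$. -}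

module Defs where

open import Data.Nat as ℕ using (ℕ; zero; suc; _∸_)
open import Data.Nat.Divisibility using (_∣?_)
open import Relation.Binary.PropositionalEquality using (_≡_)
open import Data.Nat.Properties using (m^n≢0)
open import Data.Integer as ℤ using (ℤ; +_; -[1+_]; ∣_∣)
open import Data.Rational as ℚ using (ℚ; mkℚ; _/_; 0ℚ; 1ℚ; _+_; _-_; _*_; _<_; _≤_; ↥_; ↧ₙ_)
open import Data.List using (List; []; _∷_; length)
open import Data.List.Relation.Unary.All using (All)
open import Data.Product using (Σ; _×_; ∃; ∃-syntax)
open import Relation.Nullary using (yes; no)

vℕ : ℕ → ℕ → ℕ → ℕ
vℕ (suc (suc k)) (suc f) n with suc (suc k) ∣? n
... | yes _ = suc (vℕ (suc (suc k)) f (n ℕ./ suc (suc k)))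
... | no  _ = 0
vℕ _ _ _ = 0

vN : ℕ → ℕ → ℕ
vN p n = vℕ p n n

-- p-adic valuation of a rational (junk value 0 at q = 0)
vQ : ℕ → ℚ → ℤ
vQ p q = (+ vN p ∣ ↥ q ∣) ℤ.- (+ vN p (↧ₙ q))

pPow : ℕ → ℤ → ℚ
pPow p (+ k) = (+ (p ℕ.^ k)) / 1
pPow (suc (suc m)) -[1+ k ] =
  _/_ (+ 1) ((suc (suc m)) ℕ.^ (suc k)) {{m^n≢0 (suc (suc m)) (suc k)}}
pPow _ -[1+ k ] = 0ℚ

pAbs : ℕ → ℚ → ℚ
pAbs p (mkℚ (+ 0) _ _) = 0ℚ
pAbs p q = pPow p (ℤ.- vQ p q)

-- for q ≠ 0 this is 1 / | q |_p = p ^ v_p(q)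
pAbsRecip : ℕ → ℚ → ℚ
pAbsRecip p q = pPow p (vQ p q)

-- ℚ_p as the p-adic completion of ℚ: p-adically Cauchy sequences of
-- rationals (two sequences represent the same element iff their
-- difference tends to 0; all predicates below are invariant under this).

record Qp (p : ℕ) : Set where
  field
    seq    : ℕ → ℚ
    cauchy : ∀ (k : ℕ) → ∃[ N ] ∀ m n → N ℕ.≤ m → N ℕ.≤ n →
               pAbs p (seq m - seq n) ≤ pPow p (ℤ.- (+ k))
open Qp public

-- For a p-adically Cauchy sequence y with limit y∞ and c > 0:
-- | y∞ |_p < c  (ultrametric: |y n|_p is eventually |y∞|_p, or → 0)
LimAbsLt : ℕ → (ℕ → ℚ) → ℚ → Set
LimAbsLt p y c = ∃[ N ] ∀ n → N ℕ.≤ n → pAbs p (y n) < c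

LimZero : ℕ → (ℕ → ℚ) → Set
LimZero p y = ∀ (k : ℕ) → ∃[ N ] ∀ n → N ℕ.≤ n → pAbs p (y n) ≤ pPow p (ℤ.- (+ k))

data CFType : Set where
  browkin ruban : CFType

Digit : CFType → ℕ → ℤ → Set
Digit browkin p a = (ℤ.- (+ ((p ∸ 1) ℕ./ 2))) ℤ.≤ a × a ℤ.≤ (+ ((p ∸ 1) ℕ./ 2))
Digit ruban   p a = (+ 0) ℤ.≤ a × a ℤ.≤ (+ (p ∸ 1))

digitVal : ℕ → List ℤ → ℚ
digitVal p []       = 0ℚ
digitVal p (a ∷ as) = (a / 1) + digitVal p as * pPow p (ℤ.- (+ 1))

IsDigitSum : CFType → ℕ → ℚ → Set
IsDigitSum t p b = ∃[ as ] (All (Digit t p) as × b ≡ digitVal p as)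

-- s(β) = b : b has the shape Σ_{i=r}^{0} a_i p^i (allowed digits) and
-- β − b = Σ_{i≥1} a_i p^i, i.e. | β − b |_p < 1.
IsS : CFType → (p : ℕ) → Qp p → ℚ → Set
IsS t p β b = IsDigitSum t p b × LimAbsLt p (λ n → seq β n - b) 1ℚ

IsRecipStep : (p : ℕ) → Qp p → ℚ → Qp p → Set
IsRecipStep p x b y = LimZero p (λ n → (seq x n - b) * seq y n - 1ℚ)

-- (α_i)_{i≥0}, (b_i)_{i≥0} is the (necessarily infinite) p-adic continued
-- fraction expansion of α₀ of type t: b_i = s(α_i), α_{i+1} = 1/(α_i − b_i).
IsCFExpansion : CFType → (p : ℕ) → (ℕ → Qp p) → (ℕ → ℚ) → Set
IsCFExpansion t p α b =
  (∀ i → IsS t p (α i) (b i)) × (∀ i → IsRecipStep p (α i) (b i) (α (suc i)))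

-- convergents, with index shift: Ash b k = A_{k-2}, Bsh b k = B_{k-2}

Ash : (ℕ → ℚ) → ℕ → ℚ
Ash b zero          = 0ℚ
Ash b (suc zero)    = 1ℚ
Ash b (suc (suc k)) = b k * Ash b (suc k) + Ash b k

Bsh : (ℕ → ℚ) → ℕ → ℚ
Bsh b zero          = 1ℚ
Bsh b (suc zero)    = 0ℚ
Bsh b (suc (suc k)) = b k * Bsh b (suc k) + Bsh b k

-- A_n and B_n for n ≥ -1 written as A b (n + 1) etc.; we provide
-- A_n = Aₙ b n, B_n = Bₙ b n (n ≥ 0) and A_{n-1} = Aₙ₋₁ b n.
Aₙ : (ℕ → ℚ) → ℕ → ℚ
Aₙ b n = Ash b (suc (suc n))

Aₙ₋₁ : (ℕ → ℚ) → ℕ → ℚ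
Aₙ₋₁ b n = Ash b (suc n)

Bₙ : (ℕ → ℚ) → ℕ → ℚ
Bₙ b n = Bsh b (suc (suc n))

-- total reciprocal on ℚ (junk 0 at 0)
inv : ℚ → ℚ
inv (mkℚ (+ 0) _ _)          = 0ℚ
inv q@(mkℚ (+ (suc _)) _ _)  = ℚ.1/ q
inv q@(mkℚ -[1+ _ ] _ _)     = ℚ.1/ q

-- Write θⱼ = Bⱼα − Aⱼ. With M(b) = (b 1; 1 0) one has (Aₙ Aₙ₋₁; Bₙ Bₙ₋₁) = M(b₀)M(b₁)⋯M(bₙ).
-- If b₁…bₙ is a palindrome, M(b₁)⋯M(bₙ) is symmetric, and since b₀ = 0 this gives Aₙ = Bₙ₋₁, whence
--   α² − Aₙ₋₁/Bₙ = (θₙ₋₁ + αθₙ)/Bₙ.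
-- Because |αᵢ − bᵢ|_p < 1 and αᵢ₊₁ = 1/(αᵢ − bᵢ), every bᵢ (i ≥ 1) has |bᵢ|_p > 1, so
-- |Bⱼ₊₁|_p = |bⱼ₊₁|_p|Bⱼ|_p, and αⱼ₊₁θⱼ + θⱼ₋₁ = 0 gives |θⱼ₋₁|_p ≤ 1/|Bⱼ|_p. As |α|_p < 1 the numerator
-- above has absolute value at most 1/|Bₙ|_p, so the error is at most 1/|Bₙ|_p² < |b₁|_p/|Bₙ|_p².
-- Elements of ℚ_p are Cauchy sequences of rationals, so the argument is run on the m-th rational
-- approximants, with valuation bounds that hold for all large m.

module Submission where

open import Defs
open import Data.Nat as ℕ using (ℕ; zero; suc; _∸_; z≤n; s≤s)
import Data.Nat.Properties as ℕₚ
open import Data.Nat.GCD using (gcd; gcd[m,n]≢0)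
open import Data.Nat.Primality using (Prime; euclidsLemma)
open import Data.Nat.Divisibility using (_∣_; _∤_; _∣?_; divides; ∣-trans; ∣⇒≤; ∣-reflexive; *-cancelˡ-∣; m∣m*n)
open import Data.Integer as ℤ using (ℤ; +_; -[1+_]; ∣_∣; 0ℤ; 1ℤ)
import Data.Integer.Properties as ℤₚ
import Data.Integer.Divisibility.Signed as ℤ∣
import Data.Rational.Solver as ℚ-Solver
open import Data.Rational.Unnormalised using (ℚᵘ; mkℚᵘ; *≡*; *<*)
  renaming (_/_ to _/ᵘ_; _*_ to _*ᵘ_; _≃_ to _≃ᵘ_; _<_ to _<ᵘ_)
import Data.Rational.Unnormalised.Properties as ℚᵘₚ
import Data.Rational.Properties as ℚₚ
open import Function using (_∘_)
open import Data.Product using (∃; ∃-syntax; _×_; _,_; proj₁; proj₂)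
open import Data.Sum using (_⊎_; inj₁; inj₂; [_,_]′)
open import Data.Empty using (⊥-elim)
open import Relation.Nullary using (¬_; yes; no)
open import Relation.Binary.PropositionalEquality

Eventually : (ℕ → Set) → Set
Eventually P = ∃[ M ] (∀ m → M ℕ.≤ m → P m)

eventually-map : ∀ {P Q : ℕ → Set} → (∀ {m} → P m → Q m) → Eventually P → Eventually Q
eventually-map f (M , P≥M) = M , λ m M≤m → f (P≥M m M≤m)

eventually-× : ∀ {P Q : ℕ → Set} → Eventually P → Eventually Q → Eventually (λ m → P m × Q m)
eventually-× (M , P≥M) (M′ , Q≥M′) =
  M ℕ.⊔ M′ , λ m M⊔M′≤m → P≥M m (ℕₚ.m⊔n≤o⇒m≤o M M′ M⊔M′≤m) , Q≥M′ m (ℕₚ.m⊔n≤o⇒n≤o M M′ M⊔M′≤m)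

eventually⇒some : ∀ {P : ℕ → Set} → Eventually P → ∃ P
eventually⇒some (M , P≥M) = M , P≥M M ℕₚ.≤-refl

^-monoʳ-∣ : ∀ q {a b} → a ℕ.≤ b → q ℕ.^ a ∣ q ℕ.^ b
^-monoʳ-∣ q {a} {b} a≤b =
  divides (q ℕ.^ (b ∸ a)) (trans (cong (q ℕ.^_) (sym (ℕₚ.m∸n+n≡m a≤b))) (ℕₚ.^-distribˡ-+-* q (b ∸ a) a))

/ᵘ-≃ : ∀ {i j} n m .{{_ : ℕ.NonZero n}} .{{_ : ℕ.NonZero m}} → i ℤ.* + m ≡ j ℤ.* + n → i /ᵘ n ≃ᵘ j /ᵘ m
/ᵘ-≃ (suc n) (suc m) eq = *≡* eq

/ᵘ-< : ∀ {i j} n m .{{_ : ℕ.NonZero n}} .{{_ : ℕ.NonZero m}} → i ℤ.* + m ℤ.< j ℤ.* + n → i /ᵘ n <ᵘ j /ᵘ m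
/ᵘ-< (suc n) (suc m) lt = *<* lt

/ᵘ-* : ∀ i j n m .{{_ : ℕ.NonZero n}} .{{_ : ℕ.NonZero m}} →
       (i /ᵘ n) *ᵘ (j /ᵘ m) ≃ᵘ ((i ℤ.* j) /ᵘ (n ℕ.* m)) {{ℕₚ.m*n≢0 n m}}
/ᵘ-* i j (suc n) (suc m) = ℚᵘₚ.≃-refl

-- Convergents as products of 2 × 2 matrices

module Convergents where

  open import Data.Rational using (ℚ; 0ℚ; 1ℚ; _+_; _*_)
  open ℚ-Solver.+-*-Solver using (solve; _:+_; _:*_; _:=_; con)

  record Mat : Set where
    constructor mat
    field
      m₁₁ m₁₂ m₂₁ m₂₂ : ℚ
  open Mat

  mat-cong : ∀ {a b c d a′ b′ c′ d′} → a ≡ a′ → b ≡ b′ → c ≡ c′ → d ≡ d′ → mat a b c d ≡ mat a′ b′ c′ d′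
  mat-cong refl refl refl refl = refl

  infixl 7 _⊗_
  _⊗_ : Mat → Mat → Mat
  X ⊗ Y = mat (m₁₁ X * m₁₁ Y + m₁₂ X * m₂₁ Y) (m₁₁ X * m₁₂ Y + m₁₂ X * m₂₂ Y)
              (m₂₁ X * m₁₁ Y + m₂₂ X * m₂₁ Y) (m₂₁ X * m₁₂ Y + m₂₂ X * m₂₂ Y)

  transpose : Mat → Mat
  transpose X = mat (m₁₁ X) (m₂₁ X) (m₁₂ X) (m₂₂ X)

  I : Mat
  I = mat 1ℚ 0ℚ 0ℚ 1ℚ

  cfMatrix : ℚ → Mat
  cfMatrix q = mat q 1ℚ 1ℚ 0ℚ

  ⊗-assoc : ∀ X Y Z → (X ⊗ Y) ⊗ Z ≡ X ⊗ (Y ⊗ Z)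
  ⊗-assoc X Y Z = mat-cong (entry (m₁₁ X) (m₁₂ X) (m₁₁ Z) (m₂₁ Z)) (entry (m₁₁ X) (m₁₂ X) (m₁₂ Z) (m₂₂ Z))
                           (entry (m₂₁ X) (m₂₂ X) (m₁₁ Z) (m₂₁ Z)) (entry (m₂₁ X) (m₂₂ X) (m₁₂ Z) (m₂₂ Z))
    where
    entry : ∀ a b i k → (a * m₁₁ Y + b * m₂₁ Y) * i + (a * m₁₂ Y + b * m₂₂ Y) * k
                        ≡ a * (m₁₁ Y * i + m₁₂ Y * k) + b * (m₂₁ Y * i + m₂₂ Y * k)
    entry a b i k = solve 8 (λ a b e f g h i k → (a :* e :+ b :* g) :* i :+ (a :* f :+ b :* h) :* k
                                             := a :* (e :* i :+ f :* k) :+ b :* (g :* i :+ h :* k))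
                      refl a b (m₁₁ Y) (m₁₂ Y) (m₂₁ Y) (m₂₂ Y) i k

  ⊗-identityˡ : ∀ X → I ⊗ X ≡ X
  ⊗-identityˡ X = mat-cong (unit (m₁₁ X) (m₂₁ X)) (unit (m₁₂ X) (m₂₂ X))
                           (unit′ (m₁₁ X) (m₂₁ X)) (unit′ (m₁₂ X) (m₂₂ X))
    where
    unit : ∀ a c → 1ℚ * a + 0ℚ * c ≡ a
    unit = solve 2 (λ a c → con 1ℚ :* a :+ con 0ℚ :* c := a) refl
    unit′ : ∀ a c → 0ℚ * a + 1ℚ * c ≡ c
    unit′ = solve 2 (λ a c → con 0ℚ :* a :+ con 1ℚ :* c := c) refl

  ⊗-identityʳ : ∀ X → X ⊗ I ≡ X
  ⊗-identityʳ X = mat-cong (unit (m₁₁ X) (m₁₂ X)) (unit′ (m₁₁ X) (m₁₂ X))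
                           (unit (m₂₁ X) (m₂₂ X)) (unit′ (m₂₁ X) (m₂₂ X))
    where
    unit : ∀ a b → a * 1ℚ + b * 0ℚ ≡ a
    unit = solve 2 (λ a b → a :* con 1ℚ :+ b :* con 0ℚ := a) refl
    unit′ : ∀ a b → a * 0ℚ + b * 1ℚ ≡ b
    unit′ = solve 2 (λ a b → a :* con 0ℚ :+ b :* con 1ℚ := b) refl

  transpose-⊗ : ∀ X Y → transpose (X ⊗ Y) ≡ transpose Y ⊗ transpose X
  transpose-⊗ X Y = mat-cong (swap (m₁₁ X) (m₁₁ Y) (m₁₂ X) (m₂₁ Y)) (swap (m₂₁ X) (m₁₁ Y) (m₂₂ X) (m₂₁ Y))
                             (swap (m₁₁ X) (m₁₂ Y) (m₁₂ X) (m₂₂ Y)) (swap (m₂₁ X) (m₁₂ Y) (m₂₂ X) (m₂₂ Y))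
    where
    swap : ∀ a e b g → a * e + b * g ≡ e * a + g * b
    swap = solve 4 (λ a e b g → a :* e :+ b :* g := e :* a :+ g :* b) refl

  prod : (ℕ → ℚ) → ℕ → Mat
  prod f zero    = I
  prod f (suc n) = cfMatrix (f 0) ⊗ prod (f ∘ suc) n

  prod-snoc : ∀ f n → prod f (suc n) ≡ prod f n ⊗ cfMatrix (f n)
  prod-snoc f zero    = trans (⊗-identityʳ (cfMatrix (f 0))) (sym (⊗-identityˡ (cfMatrix (f 0))))
  prod-snoc f (suc n) = trans (cong (cfMatrix (f 0) ⊗_) (prod-snoc (f ∘ suc) n))
                              (sym (⊗-assoc (cfMatrix (f 0)) (prod (f ∘ suc) n) (cfMatrix (f (suc n)))))

  prod-reverse : ∀ {f g} n → (∀ j → j ℕ.< n → g j ≡ f (n ∸ suc j)) → prod g n ≡ transpose (prod f n)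
  prod-reverse zero _ = refl
  prod-reverse {f} {g} (suc n) g≡rev[f] = begin
    prod g (suc n)                                       ≡⟨ prod-snoc g n ⟩
    prod g n ⊗ cfMatrix (g n)                            ≡⟨ cong₂ _⊗_ (prod-reverse n g≡rev[f∘suc]) (cong cfMatrix g[n]≡f[0]) ⟩
    transpose (prod (f ∘ suc) n) ⊗ transpose (cfMatrix (f 0)) ≡⟨ transpose-⊗ (cfMatrix (f 0)) (prod (f ∘ suc) n) ⟨
    transpose (prod f (suc n))                           ∎
    where
    open ≡-Reasoning
    g[n]≡f[0] : g n ≡ f 0
    g[n]≡f[0] = trans (g≡rev[f] n ℕₚ.≤-refl) (cong f (ℕₚ.n∸n≡0 n))
    g≡rev[f∘suc] : ∀ j → j ℕ.< n → g j ≡ f (suc (n ∸ suc j))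
    g≡rev[f∘suc] j j<n = trans (g≡rev[f] j (ℕₚ.m<n⇒m<1+n j<n)) (cong f (ℕₚ.+-∸-assoc 1 j<n))

  ⊗-cfMatrix : ∀ X q → X ⊗ cfMatrix q ≡ mat (q * m₁₁ X + m₁₂ X) (m₁₁ X) (q * m₂₁ X + m₂₂ X) (m₂₁ X)
  ⊗-cfMatrix X q = mat-cong (next (m₁₁ X) (m₁₂ X)) (keep (m₁₁ X) (m₁₂ X))
                            (next (m₂₁ X) (m₂₂ X)) (keep (m₂₁ X) (m₂₂ X))
    where
    next : ∀ a b → a * q + b * 1ℚ ≡ q * a + b
    next a b = solve 3 (λ a b q → a :* q :+ b :* con 1ℚ := q :* a :+ b) refl a b q
    keep : ∀ a b → a * 1ℚ + b * 0ℚ ≡ a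
    keep = solve 2 (λ a b → a :* con 1ℚ :+ b :* con 0ℚ := a) refl

  prod≡convergents : ∀ b n → prod b n ≡ mat (Ash b (suc n)) (Ash b n) (Bsh b (suc n)) (Bsh b n)
  prod≡convergents b zero    = refl
  prod≡convergents b (suc n) = begin
    prod b (suc n)             ≡⟨ prod-snoc b n ⟩
    prod b n ⊗ cfMatrix (b n)  ≡⟨ cong (_⊗ cfMatrix (b n)) (prod≡convergents b n) ⟩
    mat (Ash b (suc n)) (Ash b n) (Bsh b (suc n)) (Bsh b n) ⊗ cfMatrix (b n)
                               ≡⟨ ⊗-cfMatrix (mat (Ash b (suc n)) (Ash b n) (Bsh b (suc n)) (Bsh b n)) (b n) ⟩
    mat (Ash b (suc (suc n))) (Ash b (suc n)) (Bsh b (suc (suc n))) (Bsh b (suc n)) ∎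
    where open ≡-Reasoning

  Palindromic : (ℕ → ℚ) → ℕ → Set
  Palindromic b n = ∀ j → 1 ℕ.≤ j → j ℕ.≤ n → b j ≡ b (suc n ∸ j)

  palindromic⇒Aₙ≡Bₙ₋₁ : ∀ b n → b 0 ≡ 0ℚ → Palindromic b n → Aₙ b n ≡ Bsh b (suc n)
  palindromic⇒Aₙ≡Bₙ₋₁ b n b₀≡0 palindromic = begin
    Aₙ b n                            ≡⟨ cong m₁₁ (prod≡convergents b (suc n)) ⟨
    b 0 * m₁₁ S + 1ℚ * m₂₁ S          ≡⟨ cong (λ q → q * m₁₁ S + 1ℚ * m₂₁ S) b₀≡0 ⟩
    0ℚ * m₁₁ S + 1ℚ * m₂₁ S           ≡⟨ solve 2 (λ a c → con 0ℚ :* a :+ con 1ℚ :* c := c) refl (m₁₁ S) (m₂₁ S) ⟩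
    m₂₁ S                             ≡⟨ cong m₂₁ S≡Sᵀ ⟩
    m₁₂ S                             ≡⟨ solve 2 (λ a c → a := con 1ℚ :* a :+ con 0ℚ :* c) refl (m₁₂ S) (m₂₂ S) ⟩
    1ℚ * m₁₂ S + 0ℚ * m₂₂ S           ≡⟨ cong m₂₂ (prod≡convergents b (suc n)) ⟩
    Bsh b (suc n)                     ∎
    where
    open ≡-Reasoning
    S : Mat
    S = prod (b ∘ suc) n
    S≡Sᵀ : S ≡ transpose S
    S≡Sᵀ = prod-reverse n (λ j j<n → trans (palindromic (suc j) (s≤s z≤n) j<n) (cong b (ℕₚ.+-∸-assoc 1 j<n)))

module PAdic (k : ℕ) (p-prime : Prime (suc (suc k))) where

  p : ℕ
  p = suc (suc k)

  -- The p-adic valuation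

  module _ where
    open import Data.Nat using (_+_; _*_; _^_; _≤_; _<_)
    open import Data.Nat.Tactic.RingSolver using (solve-∀)
    open import Data.Nat.DivMod using (_/_; m*[n/m]≡n; m/n<m; m≥n⇒m/n>0)

    p∤1 : p ∤ 1
    p∤1 p∣1 with ∣⇒≤ p∣1
    ... | s≤s ()

    vℕ-factorisation : ∀ fuel n → 0 < n → n ≤ fuel → ∃[ m ] n ≡ p ^ vℕ p fuel n * m × p ∤ m
    vℕ-factorisation zero     .zero () z≤n
    vℕ-factorisation (suc fuel) n 0<n n≤1+fuel with p ∣? n
    ... | no p∤n = n , sym (ℕₚ.*-identityˡ n) , p∤n
    ... | yes p∣n with vℕ-factorisation fuel (n / p) 0<n/p n/p≤fuel
      where
      0<n/p : 0 < n / p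
      0<n/p = m≥n⇒m/n>0 (∣⇒≤ {{ℕ.>-nonZero 0<n}} p∣n)
      n/p≤fuel : n / p ≤ fuel
      n/p≤fuel = ℕₚ.≤-pred (ℕₚ.<-≤-trans (m/n<m n p {{ℕ.>-nonZero 0<n}} (s≤s (s≤s z≤n))) n≤1+fuel)
    ... | m , n/p≡ , p∤m = m , n≡ , p∤m
      where
      open ≡-Reasoning
      n≡ : n ≡ p ^ suc (vℕ p fuel (n / p)) * m
      n≡ = begin
        n                                  ≡⟨ sym (m*[n/m]≡n p∣n) ⟩
        p * (n / p)                        ≡⟨ cong (p *_) n/p≡ ⟩
        p * (p ^ vℕ p fuel (n / p) * m)    ≡⟨ sym (ℕₚ.*-assoc p (p ^ vℕ p fuel (n / p)) m) ⟩
        p ^ suc (vℕ p fuel (n / p)) * m    ∎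

    vN-factorisation : ∀ n → 0 < n → ∃[ m ] n ≡ p ^ vN p n * m × p ∤ m
    vN-factorisation n 0<n = vℕ-factorisation n n 0<n ℕₚ.≤-refl

    p∣p^[1+a]*m : ∀ a m → p ∣ p ^ suc a * m
    p∣p^[1+a]*m a m = subst (p ∣_) (sym (ℕₚ.*-assoc p (p ^ a) m)) (m∣m*n (p ^ a * m))

    ^*-exponent-unique : ∀ a b {m m′} → p ^ a * m ≡ p ^ b * m′ → p ∤ m → p ∤ m′ → a ≡ b
    ^*-exponent-unique zero    zero    eq p∤m p∤m′ = refl
    ^*-exponent-unique zero    (suc b) {m} {m′} eq p∤m p∤m′ =
      ⊥-elim (p∤m (subst (p ∣_) (trans (sym eq) (ℕₚ.*-identityˡ m)) (p∣p^[1+a]*m b m′)))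
    ^*-exponent-unique (suc a) zero    {m} {m′} eq p∤m p∤m′ =
      ⊥-elim (p∤m′ (subst (p ∣_) (trans eq (ℕₚ.*-identityˡ m′)) (p∣p^[1+a]*m a m)))
    ^*-exponent-unique (suc a) (suc b) {m} {m′} eq p∤m p∤m′ =
      cong suc (^*-exponent-unique a b (ℕₚ.*-cancelˡ-≡ _ _ p eq′) p∤m p∤m′)
      where
      eq′ : p * (p ^ a * m) ≡ p * (p ^ b * m′)
      eq′ = trans (sym (ℕₚ.*-assoc p (p ^ a) m)) (trans eq (ℕₚ.*-assoc p (p ^ b) m′))

    vN-unique : ∀ {n a m} → 0 < n → n ≡ p ^ a * m → p ∤ m → vN p n ≡ a
    vN-unique {n} 0<n n≡ p∤m with vN-factorisation n 0<n
    ... | m′ , n≡′ , p∤m′ = ^*-exponent-unique _ _ (trans (sym n≡′) n≡) p∤m′ p∤m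

    vN-1 : vN p 1 ≡ 0
    vN-1 = vN-unique (s≤s z≤n) refl p∤1

    vN-* : ∀ m n → 0 < m → 0 < n → vN p (m * n) ≡ vN p m + vN p n
    vN-* m n 0<m 0<n with vN-factorisation m 0<m | vN-factorisation n 0<n
    ... | u , m≡ , p∤u | w , n≡ , p∤w = vN-unique (ℕₚ.*-mono-< 0<m 0<n) mn≡ p∤uw
      where
      interchange : ∀ a b c d → (a * b) * (c * d) ≡ (a * c) * (b * d)
      interchange = solve-∀
      mn≡ : m * n ≡ p ^ (vN p m + vN p n) * (u * w)
      mn≡ = begin
        m * n                                        ≡⟨ cong₂ _*_ m≡ n≡ ⟩
        (p ^ vN p m * u) * (p ^ vN p n * w)          ≡⟨ interchange (p ^ vN p m) u (p ^ vN p n) w ⟩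
        (p ^ vN p m * p ^ vN p n) * (u * w)          ≡⟨ cong (_* (u * w)) (sym (ℕₚ.^-distribˡ-+-* p (vN p m) (vN p n))) ⟩
        p ^ (vN p m + vN p n) * (u * w)              ∎
        where open ≡-Reasoning
      p∤uw : p ∤ u * w
      p∤uw p∣uw with euclidsLemma u w p-prime p∣uw
      ... | inj₁ p∣u = p∤u p∣u
      ... | inj₂ p∣w = p∤w p∣w

    p^vN∣ : ∀ n → 0 < n → p ^ vN p n ∣ n
    p^vN∣ n 0<n with vN-factorisation n 0<n
    ... | m , n≡ , _ = divides m (trans n≡ (ℕₚ.*-comm (p ^ vN p n) m))

    p^c∣⇒c≤vN : ∀ {n c} → 0 < n → p ^ c ∣ n → c ≤ vN p n
    p^c∣⇒c≤vN {n} {c} 0<n p^c∣n with vN-factorisation n 0<n | ℕₚ.≤-<-connex c (vN p n)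
    ... | _ | inj₁ c≤v = c≤v
    ... | m , n≡ , p∤m | inj₂ v<c = ⊥-elim (p∤m (*-cancelˡ-∣ (p ^ v) {{ℕₚ.m^n≢0 p v}} p^v*p∣p^v*m))
      where
      v : ℕ
      v = vN p n
      p^v*p∣p^v*m : p ^ v * p ∣ p ^ v * m
      p^v*p∣p^v*m = ∣-trans (∣-trans (∣-reflexive (ℕₚ.*-comm (p ^ v) p)) (^-monoʳ-∣ p v<c)) (subst (p ^ c ∣_) n≡ p^c∣n)

  open import Data.Rational using (ℚ; mkℚ; 0ℚ; 1ℚ; ↥_; ↧_; ↧ₙ_; _+_; _*_; _-_; -_; _/_; _≟_; _<_; _≤_; toℚᵘ)
  open import Data.Integer.Tactic.RingSolver using (solve-∀)
  open ℚ-Solver.+-*-Solver using (solve; _:+_; _:-_; _:*_; :-_; _:=_; con)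

  vℤ : ℤ → ℕ
  vℤ i = vN p ∣ i ∣

  ∣i∣>0 : ∀ {i} → i ≢ 0ℤ → 0 ℕ.< ∣ i ∣
  ∣i∣>0 i≢0 = ℕₚ.n≢0⇒n>0 (i≢0 ∘ ℤₚ.∣i∣≡0⇒i≡0)

  vℤ-* : ∀ {i j} → i ≢ 0ℤ → j ≢ 0ℤ → vℤ (i ℤ.* j) ≡ vℤ i ℕ.+ vℤ j
  vℤ-* {i} {j} i≢0 j≢0 = trans (cong (vN p) (ℤₚ.∣i*j∣≡∣i∣*∣j∣ i j)) (vN-* ∣ i ∣ ∣ j ∣ (∣i∣>0 i≢0) (∣i∣>0 j≢0))

  vℤ-+ : ∀ {i j a} → i ≢ 0ℤ → j ≢ 0ℤ → i ℤ.+ j ≢ 0ℤ → a ℕ.≤ vℤ i → a ℕ.≤ vℤ j → a ℕ.≤ vℤ (i ℤ.+ j)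
  vℤ-+ {i} {j} {a} i≢0 j≢0 i+j≢0 a≤vi a≤vj =
    p^c∣⇒c≤vN (∣i∣>0 i+j≢0) (ℤ∣.∣⇒∣ᵤ (ℤ∣.∣m∣n⇒∣m+n (p^a∣ i≢0 a≤vi) (p^a∣ j≢0 a≤vj)))
    where
    p^a∣ : ∀ {l} → l ≢ 0ℤ → a ℕ.≤ vℤ l → + (p ℕ.^ a) ℤ∣.∣ l
    p^a∣ l≢0 a≤vl = ℤ∣.∣ᵤ⇒∣ (∣-trans (^-monoʳ-∣ p a≤vl) (p^vN∣ _ (∣i∣>0 l≢0)))

  v : ℚ → ℤ
  v = vQ p

  vFraction : ℤ → ℕ → ℤ
  vFraction i n = + vℤ i ℤ.- + vN p n

  vFraction-scale : ∀ {i} n g → i ≢ 0ℤ → 0 ℕ.< n → 0 ℕ.< g → vFraction (i ℤ.* + g) (n ℕ.* g) ≡ vFraction i n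
  vFraction-scale {i} n g i≢0 0<n 0<g = begin
    + vℤ (i ℤ.* + g) ℤ.- + vN p (n ℕ.* g)          ≡⟨ cong₂ (λ a b → + a ℤ.- + b) (vℤ-* i≢0 +g≢0) (vN-* n g 0<n 0<g) ⟩
    + (vℤ i ℕ.+ vN p g) ℤ.- + (vN p n ℕ.+ vN p g)  ≡⟨ cong₂ (λ a b → a ℤ.- b) (ℤₚ.pos-+ (vℤ i) (vN p g)) (ℤₚ.pos-+ (vN p n) (vN p g)) ⟩
    (+ vℤ i ℤ.+ + vN p g) ℤ.- (+ vN p n ℤ.+ + vN p g) ≡⟨ cancel (+ vℤ i) (+ vN p n) (+ vN p g) ⟩
    + vℤ i ℤ.- + vN p n                            ∎
    where
    open ≡-Reasoning
    +g≢0 : + g ≢ 0ℤ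
    +g≢0 = ℕₚ.>⇒≢ 0<g ∘ ℤₚ.+-injective
    cancel : ∀ a b c → (a ℤ.+ c) ℤ.- (b ℤ.+ c) ≡ a ℤ.- b
    cancel = solve-∀

  ↥≢0 : ∀ {q} → q ≢ 0ℚ → ↥ q ≢ 0ℤ
  ↥≢0 {q} q≢0 = q≢0 ∘ ℚₚ.↥p≡0⇒p≡0 q

  /-≢0 : ∀ {i} n .{{_ : ℕ.NonZero n}} → i ≢ 0ℤ → i / n ≢ 0ℚ
  /-≢0 {i} n i≢0 i/n≡0 = i≢0 (trans (sym (ℚₚ.↥-/ i n)) (cong (λ r → ↥ r ℤ.* + gcd ∣ i ∣ n) i/n≡0))

  v-/ : ∀ i n .{{_ : ℕ.NonZero n}} → i ≢ 0ℤ → v (i / n) ≡ vFraction i n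
  v-/ i n i≢0 = trans (sym (vFraction-scale (↧ₙ q) g (↥≢0 (/-≢0 n i≢0)) (s≤s z≤n) 0<g))
                      (cong₂ vFraction (ℚₚ.↥-/ i n) ↧q*g≡n)
    where
    q : ℚ
    q = i / n
    g : ℕ
    g = gcd ∣ i ∣ n
    ↧q*g≡n : ↧ₙ q ℕ.* g ≡ n
    ↧q*g≡n = ℤₚ.+-injective (trans (ℤₚ.pos-* (↧ₙ q) g) (ℚₚ.↧-/ i n))
    0<g : 0 ℕ.< g
    0<g = ℕₚ.n≢0⇒n>0 (gcd[m,n]≢0 ∣ i ∣ n (inj₁ (ℕₚ.>⇒≢ (∣i∣>0 i≢0))))

  i*j≢0 : ∀ {i j} → i ≢ 0ℤ → j ≢ 0ℤ → i ℤ.* j ≢ 0ℤ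
  i*j≢0 {i} i≢0 j≢0 ij≡0 = [ i≢0 , j≢0 ]′ (ℤₚ.i*j≡0⇒i≡0∨j≡0 i ij≡0)

  v-* : ∀ {x y} → x ≢ 0ℚ → y ≢ 0ℚ → v (x * y) ≡ v x ℤ.+ v y
  v-* {x@(mkℚ _ _ _)} {y@(mkℚ _ _ _)} x≢0 y≢0 = begin
    v (x * y)                                      ≡⟨ v-/ (↥ x ℤ.* ↥ y) (↧ₙ x ℕ.* ↧ₙ y) (i*j≢0 ↥x≢0 ↥y≢0) ⟩
    + vℤ (↥ x ℤ.* ↥ y) ℤ.- + vN p (↧ₙ x ℕ.* ↧ₙ y)  ≡⟨ cong₂ (λ a b → + a ℤ.- + b) (vℤ-* ↥x≢0 ↥y≢0) (vN-* (↧ₙ x) (↧ₙ y) (s≤s z≤n) (s≤s z≤n)) ⟩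
    + (a ℕ.+ b) ℤ.- + (d ℕ.+ e)                    ≡⟨ cong₂ ℤ._-_ (ℤₚ.pos-+ a b) (ℤₚ.pos-+ d e) ⟩
    (+ a ℤ.+ + b) ℤ.- (+ d ℤ.+ + e)                ≡⟨ regroup (+ a) (+ b) (+ d) (+ e) ⟩
    v x ℤ.+ v y                                    ∎
    where
    open ≡-Reasoning
    ↥x≢0 : ↥ x ≢ 0ℤ
    ↥x≢0 = ↥≢0 x≢0
    ↥y≢0 : ↥ y ≢ 0ℤ
    ↥y≢0 = ↥≢0 y≢0
    a b d e : ℕ
    a = vℤ (↥ x)
    b = vℤ (↥ y)
    d = vN p (↧ₙ x)
    e = vN p (↧ₙ y)
    regroup : ∀ a b c d → (a ℤ.+ b) ℤ.- (c ℤ.+ d) ≡ (a ℤ.- c) ℤ.+ (b ℤ.- d)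
    regroup = solve-∀

  v-neg : ∀ x → v (- x) ≡ v x
  v-neg x = cong₂ (λ a b → + vN p a ℤ.- + vN p b)
                  (trans (cong ∣_∣ (ℚₚ.↥-neg x)) (ℤₚ.∣-i∣≡∣i∣ (↥ x))) (cong ∣_∣ (ℚₚ.↧-neg x))

  v-1 : v 1ℚ ≡ 0ℤ
  v-1 = cong (λ a → + a ℤ.- + a) vN-1

  vFraction-+ : ∀ {i j n c} → i ≢ 0ℤ → j ≢ 0ℤ → i ℤ.+ j ≢ 0ℤ →
                c ℤ.≤ vFraction i n → c ℤ.≤ vFraction j n → c ℤ.≤ vFraction (i ℤ.+ j) n
  vFraction-+ {i} {j} {n} i≢0 j≢0 i+j≢0 c≤i c≤j with ℕₚ.≤-total (vℤ i) (vℤ j)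
  ... | inj₁ vi≤vj = ℤₚ.≤-trans c≤i (ℤₚ.+-monoˡ-≤ (ℤ.- + vN p n) (ℤ.+≤+ (vℤ-+ i≢0 j≢0 i+j≢0 ℕₚ.≤-refl vi≤vj)))
  ... | inj₂ vj≤vi = ℤₚ.≤-trans c≤j (ℤₚ.+-monoˡ-≤ (ℤ.- + vN p n) (ℤ.+≤+ (vℤ-+ i≢0 j≢0 i+j≢0 vj≤vi ℕₚ.≤-refl)))

  -- c ≤ᵥ q means c ≤ v q with v 0 read as +∞ (vQ gives 0 the junk valuation 0).
  infix 4 _≤ᵥ_
  _≤ᵥ_ : ℤ → ℚ → Set
  c ≤ᵥ q = q ≡ 0ℚ ⊎ c ℤ.≤ v q

  ≤ᵥ⇒≤v : ∀ {c q} → q ≢ 0ℚ → c ≤ᵥ q → c ℤ.≤ v q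
  ≤ᵥ⇒≤v q≢0 (inj₁ q≡0) = ⊥-elim (q≢0 q≡0)
  ≤ᵥ⇒≤v q≢0 (inj₂ c≤vq) = c≤vq

  ≤ᵥ-refl : ∀ q → v q ≤ᵥ q
  ≤ᵥ-refl q = inj₂ ℤₚ.≤-refl

  ≤ᵥ-weaken : ∀ {c c′ q} → c′ ℤ.≤ c → c ≤ᵥ q → c′ ≤ᵥ q
  ≤ᵥ-weaken c′≤c (inj₁ q≡0) = inj₁ q≡0
  ≤ᵥ-weaken c′≤c (inj₂ c≤vq) = inj₂ (ℤₚ.≤-trans c′≤c c≤vq)

  ultrametric : ∀ {c x y} → x ≢ 0ℚ → y ≢ 0ℚ → c ℤ.≤ v x → c ℤ.≤ v y → c ≤ᵥ x + y
  ultrametric {c} {x@(mkℚ _ _ _)} {y@(mkℚ _ _ _)} x≢0 y≢0 c≤vx c≤vy with ↥ x ℤ.* ↧ y ℤ.+ ↥ y ℤ.* ↧ x ℤ.≟ 0ℤ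
  ... | yes U+W≡0 = inj₁ (trans (cong (_/ (↧ₙ x ℕ.* ↧ₙ y)) U+W≡0) (ℚₚ.0/n≡0 (↧ₙ x ℕ.* ↧ₙ y)))
  ... | no U+W≢0 = inj₂ (subst (c ℤ.≤_) (sym (v-/ (U ℤ.+ W) (↧ₙ x ℕ.* ↧ₙ y) U+W≢0))
                                (vFraction-+ {n = ↧ₙ x ℕ.* ↧ₙ y} U≢0 W≢0 U+W≢0 c≤U c≤W))
    where
    U W : ℤ
    U = ↥ x ℤ.* ↧ y
    W = ↥ y ℤ.* ↧ x
    U≢0 : U ≢ 0ℤ
    U≢0 = i*j≢0 (↥≢0 x≢0) (λ ())
    W≢0 : W ≢ 0ℤ
    W≢0 = i*j≢0 (↥≢0 y≢0) (λ ())
    c≤U : c ℤ.≤ vFraction U (↧ₙ x ℕ.* ↧ₙ y)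
    c≤U = subst (c ℤ.≤_) (sym (vFraction-scale (↧ₙ x) (↧ₙ y) (↥≢0 x≢0) (s≤s z≤n) (s≤s z≤n))) c≤vx
    c≤W : c ℤ.≤ vFraction W (↧ₙ x ℕ.* ↧ₙ y)
    c≤W = subst (c ℤ.≤_) (trans (sym (vFraction-scale (↧ₙ y) (↧ₙ x) (↥≢0 y≢0) (s≤s z≤n) (s≤s z≤n)))
                                (cong (vFraction W) (ℕₚ.*-comm (↧ₙ y) (↧ₙ x)))) c≤vy

  ≤ᵥ-+ : ∀ {c x y} → c ≤ᵥ x → c ≤ᵥ y → c ≤ᵥ x + y
  ≤ᵥ-+ {c} {x} {y} c≤x c≤y with x ≟ 0ℚ | y ≟ 0ℚ
  ... | yes refl | _ = subst (c ≤ᵥ_) (sym (ℚₚ.+-identityˡ y)) c≤y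
  ... | no _ | yes refl = subst (c ≤ᵥ_) (sym (ℚₚ.+-identityʳ x)) c≤x
  ... | no x≢0 | no y≢0 = ultrametric x≢0 y≢0 (≤ᵥ⇒≤v x≢0 c≤x) (≤ᵥ⇒≤v y≢0 c≤y)

  ≤ᵥ-neg : ∀ {c x} → c ≤ᵥ x → c ≤ᵥ - x
  ≤ᵥ-neg (inj₁ refl) = inj₁ refl
  ≤ᵥ-neg {c} {x} (inj₂ c≤vx) = inj₂ (subst (c ℤ.≤_) (sym (v-neg x)) c≤vx)

  ≤ᵥ-minus : ∀ {c x y} → c ≤ᵥ x → c ≤ᵥ y → c ≤ᵥ x - y
  ≤ᵥ-minus c≤x c≤y = ≤ᵥ-+ c≤x (≤ᵥ-neg c≤y)

  x*y≢0 : ∀ {x y} → x ≢ 0ℚ → y ≢ 0ℚ → x * y ≢ 0ℚ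
  x*y≢0 {x@(mkℚ _ _ _)} {y@(mkℚ _ _ _)} x≢0 y≢0 = /-≢0 (↧ₙ x ℕ.* ↧ₙ y) (i*j≢0 (↥≢0 x≢0) (↥≢0 y≢0))

  ≤ᵥ-* : ∀ {a b x y} → a ≤ᵥ x → b ≤ᵥ y → a ℤ.+ b ≤ᵥ x * y
  ≤ᵥ-* {a} {b} {x} {y} a≤x b≤y with x ≟ 0ℚ | y ≟ 0ℚ
  ... | yes refl | _ = inj₁ (ℚₚ.*-zeroˡ y)
  ... | no _ | yes refl = inj₁ (ℚₚ.*-zeroʳ x)
  ... | no x≢0 | no y≢0 =
    inj₂ (subst (a ℤ.+ b ℤ.≤_) (sym (v-* x≢0 y≢0)) (ℤₚ.+-mono-≤ (≤ᵥ⇒≤v x≢0 a≤x) (≤ᵥ⇒≤v y≢0 b≤y)))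

  v-+-dominant : ∀ {x y} → x ≢ 0ℚ → ℤ.suc (v x) ≤ᵥ y → x + y ≢ 0ℚ × v (x + y) ≡ v x
  v-+-dominant {x} {y} x≢0 y-small =
    x+y≢0 , ℤₚ.≤-antisym (ℤₚ.≮⇒≥ (no-gain ∘ inj₂ ∘ ℤₚ.i<j⇒suc[i]≤j)) (≤ᵥ⇒≤v x+y≢0 vx≤x+y)
    where
    x+y-y≡x : x + y - y ≡ x
    x+y-y≡x = solve 2 (λ x y → x :+ y :- y := x) refl x y
    no-gain : ¬ (ℤ.suc (v x) ≤ᵥ x + y)
    no-gain h = ℤₚ.<-irrefl refl
      (ℤₚ.suc[i]≤j⇒i<j (≤ᵥ⇒≤v x≢0 (subst (ℤ.suc (v x) ≤ᵥ_) x+y-y≡x (≤ᵥ-minus h y-small))))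
    x+y≢0 : x + y ≢ 0ℚ
    x+y≢0 = no-gain ∘ inj₁
    vx≤x+y : v x ≤ᵥ x + y
    vx≤x+y = ≤ᵥ-+ (≤ᵥ-refl x) (≤ᵥ-weaken (ℤₚ.i≤suc[i] (v x)) y-small)

  [a+b]-a≡b : ∀ a b → a ℤ.+ b ℤ.- a ≡ b
  [a+b]-a≡b = solve-∀

  ≤ᵥ-cancelˡ-* : ∀ {c x t} → x ≢ 0ℚ → c ≤ᵥ x * t → c ℤ.- v x ≤ᵥ t
  ≤ᵥ-cancelˡ-* {c} {x} {t} x≢0 c≤xt with t ≟ 0ℚ
  ... | yes t≡0 = inj₁ t≡0
  ... | no t≢0 = inj₂ (ℤₚ.≤-trans (ℤₚ.+-monoˡ-≤ (ℤ.- v x) c≤vx+vt) (ℤₚ.≤-reflexive ([a+b]-a≡b (v x) (v t))))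
    where
    c≤vx+vt : c ℤ.≤ v x ℤ.+ v t
    c≤vx+vt = subst (c ℤ.≤_) (v-* x≢0 t≢0) (≤ᵥ⇒≤v (x*y≢0 x≢0 t≢0) c≤xt)

  inv-inverseʳ : ∀ {q} → q ≢ 0ℚ → q * inv q ≡ 1ℚ
  inv-inverseʳ {mkℚ (+ zero) _ _} q≢0 = ⊥-elim (q≢0 (ℚₚ.↥p≡0⇒p≡0 _ refl))
  inv-inverseʳ {q@(mkℚ (+ suc _) _ _)} _ = ℚₚ.*-inverseʳ q
  inv-inverseʳ {q@(mkℚ -[1+ _ ] _ _)} _ = ℚₚ.*-inverseʳ q

  v-inv : ∀ {q} → q ≢ 0ℚ → v (inv q) ≡ ℤ.- v q
  v-inv {q} q≢0 = begin
    v (inv q)                       ≡⟨ [a+b]-a≡b (v q) (v (inv q)) ⟨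
    (v q ℤ.+ v (inv q)) ℤ.- v q     ≡⟨ cong (ℤ._- v q) v[q]+v[inv[q]]≡0 ⟩
    0ℤ ℤ.- v q                      ≡⟨ ℤₚ.+-identityˡ (ℤ.- v q) ⟩
    ℤ.- v q                         ∎
    where
    open ≡-Reasoning
    inv≢0 : inv q ≢ 0ℚ
    inv≢0 inv≡0 with trans (sym (inv-inverseʳ q≢0)) (trans (cong (q *_) inv≡0) (ℚₚ.*-zeroʳ q))
    ... | ()
    v[q]+v[inv[q]]≡0 : v q ℤ.+ v (inv q) ≡ 0ℤ
    v[q]+v[inv[q]]≡0 = trans (sym (v-* q≢0 inv≢0)) (trans (cong v (inv-inverseʳ q≢0)) v-1)

  ¬0≤ᵥ⇒v≤-1 : ∀ {q} → ¬ (0ℤ ≤ᵥ q) → q ≢ 0ℚ × v q ℤ.≤ ℤ.-1ℤ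
  ¬0≤ᵥ⇒v≤-1 {q} 0≰q = 0≰q ∘ inj₁ , ℤₚ.i<j⇒i≤pred[j] (ℤₚ.≰⇒> (0≰q ∘ inj₂))

  ¬1≤ᵥ1 : ¬ (1ℤ ≤ᵥ 1ℚ)
  ¬1≤ᵥ1 1≤1 with subst (1ℤ ℤ.≤_) v-1 (≤ᵥ⇒≤v (λ ()) 1≤1)
  ... | ℤ.+≤+ ()

  toℚᵘ-/ : ∀ i n .{{_ : ℕ.NonZero n}} → toℚᵘ (i / n) ≃ᵘ i /ᵘ n
  toℚᵘ-/ i (suc n) = ℚₚ.toℚᵘ-fromℚᵘ (mkℚᵘ i n)

  p^≢0 : ∀ n → ℕ.NonZero (p ℕ.^ n)
  p^≢0 n = ℕₚ.m^n≢0 p n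

  pFrac : ℕ → ℕ → ℚᵘ
  pFrac i j = (+ (p ℕ.^ i) /ᵘ p ℕ.^ j) {{p^≢0 j}}

  +p^-* : ∀ a b → + (p ℕ.^ a) ℤ.* + (p ℕ.^ b) ≡ + (p ℕ.^ (a ℕ.+ b))
  +p^-* a b = trans (sym (ℤₚ.pos-* (p ℕ.^ a) (p ℕ.^ b))) (cong +_ (sym (ℕₚ.^-distribˡ-+-* p a b)))

  pFrac-≃ : ∀ i j s t → i ℕ.+ t ≡ s ℕ.+ j → pFrac i j ≃ᵘ pFrac s t
  pFrac-≃ i j s t eq = /ᵘ-≃ (p ℕ.^ j) (p ℕ.^ t) {{p^≢0 j}} {{p^≢0 t}}
    (trans (+p^-* i t) (trans (cong (λ n → + (p ℕ.^ n)) eq) (sym (+p^-* s j))))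

  pFrac-< : ∀ i j s t → i ℕ.+ t ℕ.< s ℕ.+ j → pFrac i j <ᵘ pFrac s t
  pFrac-< i j s t lt = /ᵘ-< (p ℕ.^ j) (p ℕ.^ t) {{p^≢0 j}} {{p^≢0 t}}
    (subst₂ ℤ._<_ (sym (+p^-* i t)) (sym (+p^-* s j)) (ℤ.+<+ (ℕₚ.^-monoʳ-< p (s≤s (s≤s z≤n)) lt)))

  pFrac-* : ∀ i j s t → pFrac i j *ᵘ pFrac s t ≃ᵘ pFrac (i ℕ.+ s) (j ℕ.+ t)
  pFrac-* i j s t = ℚᵘₚ.≃-trans (/ᵘ-* (+ (p ℕ.^ i)) (+ (p ℕ.^ s)) (p ℕ.^ j) (p ℕ.^ t) {{p^≢0 j}} {{p^≢0 t}})
    (/ᵘ-≃ (p ℕ.^ j ℕ.* p ℕ.^ t) (p ℕ.^ (j ℕ.+ t)) {{ℕₚ.m*n≢0 _ _ {{p^≢0 j}} {{p^≢0 t}}}} {{p^≢0 (j ℕ.+ t)}}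
      (cong₂ ℤ._*_ (+p^-* i s) (cong +_ (ℕₚ.^-distribˡ-+-* p j t))))

  pPow-canonical : ∀ e → ∃[ i ] ∃[ j ] e ≡ + i ℤ.- + j × toℚᵘ (pPow p e) ≃ᵘ pFrac i j
  pPow-canonical (+ i)    = i , 0 , sym (ℤₚ.+-identityʳ (+ i)) , toℚᵘ-/ (+ (p ℕ.^ i)) 1
  pPow-canonical -[1+ j ] = 0 , suc j , refl , toℚᵘ-/ (+ 1) (p ℕ.^ suc j) {{p^≢0 (suc j)}}

  +i-+j+[j+l] : ∀ i j l → (+ i ℤ.- + j) ℤ.+ + (j ℕ.+ l) ≡ + (i ℕ.+ l)
  +i-+j+[j+l] i j l = begin
    (+ i ℤ.- + j) ℤ.+ + (j ℕ.+ l)     ≡⟨ cong (λ x → (+ i ℤ.- + j) ℤ.+ x) (ℤₚ.pos-+ j l) ⟩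
    (+ i ℤ.- + j) ℤ.+ (+ j ℤ.+ + l)   ≡⟨ cancel (+ i) (+ j) (+ l) ⟩
    + i ℤ.+ + l                       ≡⟨ ℤₚ.pos-+ i l ⟨
    + (i ℕ.+ l)                       ∎
    where
    open ≡-Reasoning
    cancel : ∀ a b c → (a ℤ.- b) ℤ.+ (b ℤ.+ c) ≡ a ℤ.+ c
    cancel = solve-∀

  +i-+j≡+k-+l⇒i+l≡k+j : ∀ i j k l → + i ℤ.- + j ≡ + k ℤ.- + l → i ℕ.+ l ≡ k ℕ.+ j
  +i-+j≡+k-+l⇒i+l≡k+j i j k l eq = ℤₚ.+-injective (begin
    + (i ℕ.+ l)                       ≡⟨ +i-+j+[j+l] i j l ⟨
    (+ i ℤ.- + j) ℤ.+ + (j ℕ.+ l)     ≡⟨ cong₂ ℤ._+_ eq (cong +_ (ℕₚ.+-comm j l)) ⟩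
    (+ k ℤ.- + l) ℤ.+ + (l ℕ.+ j)     ≡⟨ +i-+j+[j+l] k l j ⟩
    + (k ℕ.+ j)                       ∎)
    where open ≡-Reasoning

  +i-+j<+k-+l⇒i+l<k+j : ∀ i j k l → + i ℤ.- + j ℤ.< + k ℤ.- + l → i ℕ.+ l ℕ.< k ℕ.+ j
  +i-+j<+k-+l⇒i+l<k+j i j k l lt = ℤₚ.drop‿+<+ (subst₂ ℤ._<_ (+i-+j+[j+l] i j l)
    (trans (cong (λ x → (+ k ℤ.- + l) ℤ.+ + x) (ℕₚ.+-comm j l)) (+i-+j+[j+l] k l j))
    (ℤₚ.+-monoˡ-< (+ (j ℕ.+ l)) lt))

  pPow-≃ : ∀ {e} i j → e ≡ + i ℤ.- + j → toℚᵘ (pPow p e) ≃ᵘ pFrac i j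
  pPow-≃ {e} i j e≡i-j with pPow-canonical e
  ... | s , t , e≡s-t , pPow≃ = ℚᵘₚ.≃-trans pPow≃ (pFrac-≃ s t i j (+i-+j≡+k-+l⇒i+l≡k+j s t i j (trans (sym e≡s-t) e≡i-j)))

  pPow-+ : ∀ a b → pPow p (a ℤ.+ b) ≡ pPow p a * pPow p b
  pPow-+ a b with pPow-canonical a | pPow-canonical b
  ... | i , j , a≡i-j , a≃ | s , t , b≡s-t , b≃ = ℚₚ.toℚᵘ-injective (ℚᵘₚ.≃-trans
    (pPow-≃ (i ℕ.+ s) (j ℕ.+ t) a+b≡)
    (ℚᵘₚ.≃-sym (ℚᵘₚ.≃-trans (ℚₚ.toℚᵘ-homo-* (pPow p a) (pPow p b))
                 (ℚᵘₚ.≃-trans (ℚᵘₚ.*-cong a≃ b≃) (pFrac-* i j s t)))))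
    where
    open ≡-Reasoning
    regroup : ∀ a b c d → (a ℤ.- b) ℤ.+ (c ℤ.- d) ≡ (a ℤ.+ c) ℤ.- (b ℤ.+ d)
    regroup = solve-∀
    a+b≡ : a ℤ.+ b ≡ + (i ℕ.+ s) ℤ.- + (j ℕ.+ t)
    a+b≡ = begin
      a ℤ.+ b                                ≡⟨ cong₂ ℤ._+_ a≡i-j b≡s-t ⟩
      (+ i ℤ.- + j) ℤ.+ (+ s ℤ.- + t)        ≡⟨ regroup (+ i) (+ j) (+ s) (+ t) ⟩
      (+ i ℤ.+ + s) ℤ.- (+ j ℤ.+ + t)        ≡⟨ cong₂ ℤ._-_ (ℤₚ.pos-+ i s) (ℤₚ.pos-+ j t) ⟨
      + (i ℕ.+ s) ℤ.- + (j ℕ.+ t)            ∎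

  pPow-< : ∀ {a b} → a ℤ.< b → pPow p a < pPow p b
  pPow-< {a} {b} a<b with pPow-canonical a | pPow-canonical b
  ... | i , j , refl , a≃ | s , t , refl , b≃ =
    ℚₚ.toℚᵘ-cancel-< (ℚᵘₚ.<-respˡ-≃ (ℚᵘₚ.≃-sym a≃) (ℚᵘₚ.<-respʳ-≃ (ℚᵘₚ.≃-sym b≃)
      (pFrac-< i j s t (+i-+j<+k-+l⇒i+l<k+j i j s t a<b))))

  pPow-≤ : ∀ {a b} → a ℤ.≤ b → pPow p a ≤ pPow p b
  pPow-≤ {a} {b} a≤b with a ℤ.≟ b
  ... | yes refl = ℚₚ.≤-refl
  ... | no a≢b = ℚₚ.<⇒≤ (pPow-< (ℤₚ.≤∧≢⇒< a≤b a≢b))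

  pPow-pos : ∀ e → 0ℚ < pPow p e
  pPow-pos e with pPow-canonical e
  ... | i , j , _ , e≃ = ℚₚ.toℚᵘ-cancel-< (ℚᵘₚ.<-respʳ-≃ (ℚᵘₚ.≃-sym e≃)
    (/ᵘ-< 1 (p ℕ.^ j) {{_}} {{p^≢0 j}} (ℤₚ.<-≤-trans (ℤ.+<+ (ℕₚ.m^n>0 p i)) (ℤₚ.≤-reflexive (sym (ℤₚ.*-identityʳ _))))))

  pAbs-≢0 : ∀ {q} → q ≢ 0ℚ → pAbs p q ≡ pPow p (ℤ.- v q)
  pAbs-≢0 {mkℚ (+ zero) _ _} q≢0 = ⊥-elim (q≢0 (ℚₚ.↥p≡0⇒p≡0 _ refl))
  pAbs-≢0 {mkℚ (+ suc _) _ _} _ = refl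
  pAbs-≢0 {mkℚ -[1+ _ ] _ _}  _ = refl

  pAbs<pPow⇒≤ᵥ : ∀ {q} c → pAbs p q < pPow p (ℤ.- c) → ℤ.suc c ≤ᵥ q
  pAbs<pPow⇒≤ᵥ {q} c |q|<p^-c with q ≟ 0ℚ
  ... | yes q≡0 = inj₁ q≡0
  ... | no q≢0 with ℤ.suc c ℤ.≤? v q
  ...   | yes c<vq = inj₂ c<vq
  ...   | no c≮vq = ⊥-elim (ℚₚ.<-irrefl refl (ℚₚ.<-≤-trans |q|<p^-c p^-c≤|q|))
    where
    p^-c≤|q| : pPow p (ℤ.- c) ≤ pAbs p q
    p^-c≤|q| = subst (pPow p (ℤ.- c) ≤_) (sym (pAbs-≢0 q≢0))
                 (pPow-≤ (ℤₚ.neg-mono-≤ {v q} {c} (ℤₚ.≮⇒≥ (c≮vq ∘ ℤₚ.i<j⇒suc[i]≤j))))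

  pAbs≤pPow⇒≤ᵥ : ∀ {q} c → pAbs p q ≤ pPow p (ℤ.- c) → c ≤ᵥ q
  pAbs≤pPow⇒≤ᵥ {q} c |q|≤p^-c with q ≟ 0ℚ
  ... | yes q≡0 = inj₁ q≡0
  ... | no q≢0 with c ℤ.≤? v q
  ...   | yes c≤vq = inj₂ c≤vq
  ...   | no c≰vq = ⊥-elim (ℚₚ.<-irrefl refl (ℚₚ.<-≤-trans p^-c<|q| |q|≤p^-c))
    where
    p^-c<|q| : pPow p (ℤ.- c) < pAbs p q
    p^-c<|q| = subst (pPow p (ℤ.- c) <_) (sym (pAbs-≢0 q≢0)) (pPow-< (ℤₚ.neg-mono-< (ℤₚ.≰⇒> c≰vq)))

  ≤ᵥ⇒pAbs< : ∀ {y c d} → ℤ.- c ℤ.< d → c ≤ᵥ y → pAbs p y < pPow p d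
  ≤ᵥ⇒pAbs< {d = d} -c<d (inj₁ refl) = pPow-pos d
  ≤ᵥ⇒pAbs< {y} {c} {d} -c<d (inj₂ c≤vy) with y ≟ 0ℚ
  ... | yes refl = pPow-pos d
  ... | no y≢0 = subst (_< pPow p d) (sym (pAbs-≢0 y≢0)) (pPow-< (ℤₚ.≤-<-trans (ℤₚ.neg-mono-≤ c≤vy) -c<d))

  -- Valuation bounds along sequences

  Bounded : (ℕ → ℚ) → Set
  Bounded f = ∃[ c ] Eventually (λ m → c ≤ᵥ f m)

  Null : (ℕ → ℚ) → Set
  Null f = ∀ c → Eventually (λ m → c ≤ᵥ f m)

  bounded-const : ∀ q → Bounded (λ _ → q)
  bounded-const q = v q , 0 , λ _ _ → ≤ᵥ-refl q

  bounded-minus : ∀ {f g} → Bounded f → Bounded g → Bounded (λ m → f m - g m)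
  bounded-minus (c , f≥c) (d , g≥d) =
    c ℤ.⊓ d , eventually-map (λ (fₘ≥c , gₘ≥d) → ≤ᵥ-minus (≤ᵥ-weaken (ℤₚ.i⊓j≤i c d) fₘ≥c) (≤ᵥ-weaken (ℤₚ.i⊓j≤j c d) gₘ≥d))
                             (eventually-× f≥c g≥d)

  bounded-* : ∀ {f g} → Bounded f → Bounded g → Bounded (λ m → f m * g m)
  bounded-* (c , f≥c) (d , g≥d) = c ℤ.+ d , eventually-map (λ (fₘ≥c , gₘ≥d) → ≤ᵥ-* fₘ≥c gₘ≥d) (eventually-× f≥c g≥d)

  null-minus : ∀ {f g} → Null f → Null g → Null (λ m → f m - g m)
  null-minus f→0 g→0 c = eventually-map (λ (fₘ≥c , gₘ≥c) → ≤ᵥ-minus fₘ≥c gₘ≥c) (eventually-× (f→0 c) (g→0 c))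

  bounded-*-null : ∀ {f g} → Bounded f → Null g → Null (λ m → f m * g m)
  bounded-*-null (c , f≥c) g→0 e =
    eventually-map (λ (fₘ≥c , gₘ≥e-c) → subst (_≤ᵥ _) (c+[e-c]≡e c e) (≤ᵥ-* fₘ≥c gₘ≥e-c)) (eventually-× f≥c (g→0 (e ℤ.- c)))
    where
    c+[e-c]≡e : ∀ c e → c ℤ.+ (e ℤ.- c) ≡ e
    c+[e-c]≡e = solve-∀

  null-resp-≗ : ∀ {f g} → f ≗ g → Null f → Null g
  null-resp-≗ f≗g f→0 c = eventually-map (λ {m} → subst (c ≤ᵥ_) (f≗g m)) (f→0 c)

  i≤+∣i∣ : ∀ i → i ℤ.≤ + ∣ i ∣
  i≤+∣i∣ (+ n)    = ℤₚ.≤-refl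
  i≤+∣i∣ -[1+ n ] = ℤ.-≤+

  limZero⇒null : ∀ {f} → LimZero p f → Null f
  limZero⇒null f→0 c = eventually-map (≤ᵥ-weaken (i≤+∣i∣ c) ∘ pAbs≤pPow⇒≤ᵥ (+ ∣ c ∣)) (f→0 ∣ c ∣)

  -- The continued fraction expansion

  module Denominators (b : ℕ → ℚ) (b≢0 : ∀ i → b (suc i) ≢ 0ℚ) (v[b]≤-1 : ∀ i → v (b (suc i)) ℤ.≤ ℤ.-1ℤ) where

    B₀≡1 : Bₙ b 0 ≡ 1ℚ
    B₀≡1 = solve 1 (λ q → q :* con 0ℚ :+ con 1ℚ := con 1ℚ) refl (b 0)

    B₀≢0 : Bₙ b 0 ≢ 0ℚ
    B₀≢0 B₀≡0 with trans (sym B₀≡1) B₀≡0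
    ... | ()

    -- Since v(bⱼ₊₂Bⱼ₊₁) < v(Bⱼ), the first summand of Bⱼ₊₂ = bⱼ₊₂Bⱼ₊₁ + Bⱼ fixes its valuation.
    denominator-growth : ∀ j → Bₙ b (suc j) ≢ 0ℚ × v (Bₙ b (suc j)) ≡ v (b (suc j)) ℤ.+ v (Bₙ b j)
    denominator-growth zero = B₁≢0 , trans (cong v B₁≡b₁B₀) (v-* (b≢0 0) B₀≢0)
      where
      B₁≡b₁B₀ : Bₙ b 1 ≡ b 1 * Bₙ b 0
      B₁≡b₁B₀ = ℚₚ.+-identityʳ (b 1 * Bₙ b 0)
      B₁≢0 : Bₙ b 1 ≢ 0ℚ
      B₁≢0 = subst (_≢ 0ℚ) (sym B₁≡b₁B₀) (x*y≢0 (b≢0 0) B₀≢0)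
    denominator-growth (suc j) with denominator-growth j
    ... | Bⱼ₊₁≢0 , v[Bⱼ₊₁] = proj₁ sum , trans (proj₂ sum) (v-* (b≢0 (suc j)) Bⱼ₊₁≢0)
      where
      v[bBⱼ₊₁] : v (b (suc (suc j)) * Bₙ b (suc j)) ≡ v (b (suc (suc j))) ℤ.+ (v (b (suc j)) ℤ.+ v (Bₙ b j))
      v[bBⱼ₊₁] = trans (v-* (b≢0 (suc j)) Bⱼ₊₁≢0) (cong (λ w → v (b (suc (suc j))) ℤ.+ w) v[Bⱼ₊₁])
      dominant : ℤ.suc (v (b (suc (suc j))) ℤ.+ (v (b (suc j)) ℤ.+ v (Bₙ b j))) ℤ.≤ v (Bₙ b j)
      dominant = ℤₚ.≤-trans (ℤₚ.+-monoʳ-≤ 1ℤ (ℤₚ.+-mono-≤ (v[b]≤-1 (suc j)) (ℤₚ.+-monoˡ-≤ (v (Bₙ b j)) (v[b]≤-1 j))))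
                            (ℤₚ.≤-trans (ℤₚ.≤-reflexive (two-steps (v (Bₙ b j)))) (ℤₚ.i-j≤i (v (Bₙ b j)) 1ℤ))
        where
        two-steps : ∀ w → 1ℤ ℤ.+ (ℤ.-1ℤ ℤ.+ (ℤ.-1ℤ ℤ.+ w)) ≡ w ℤ.- 1ℤ
        two-steps = solve-∀
      sum : Bₙ b (suc (suc j)) ≢ 0ℚ × v (Bₙ b (suc (suc j))) ≡ v (b (suc (suc j)) * Bₙ b (suc j))
      sum = v-+-dominant (x*y≢0 (b≢0 (suc j)) Bⱼ₊₁≢0) (inj₂ (subst (λ z → ℤ.suc z ℤ.≤ v (Bₙ b j)) (sym v[bBⱼ₊₁]) dominant))

    Bₙ≢0 : ∀ j → Bₙ b j ≢ 0ℚ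
    Bₙ≢0 zero    = B₀≢0
    Bₙ≢0 (suc j) = proj₁ (denominator-growth j)

    v-Bₙ₊₁ : ∀ j → v (Bₙ b (suc j)) ≡ v (b (suc j)) ℤ.+ v (Bₙ b j)
    v-Bₙ₊₁ j = proj₂ (denominator-growth j)

  a+[x-a]≡x : ∀ a x → a + (x - a) ≡ x
  a+[x-a]≡x = solve 2 (λ a x → a :+ (x :- a) := x) refl

  -- x i is a sequence of rationals converging to αᵢ; the hypotheses say |αᵢ − bᵢ|_p < 1 and
  -- (αᵢ − bᵢ)αᵢ₊₁ = 1.
  module Expansion (b : ℕ → ℚ) (x : ℕ → ℕ → ℚ)
    (digit-close : ∀ i → Eventually (λ m → 1ℤ ≤ᵥ x i m - b i))
    (reciprocal : ∀ i → Null (λ m → (x i m - b i) * x (suc i) m - 1ℚ)) where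

    e : ℕ → ℕ → ℚ
    e i m = (x i m - b i) * x (suc i) m - 1ℚ

    -- If |bᵢ₊₁|_p ≤ 1 then |αᵢ₊₁|_p ≤ 1, and 1 = (αᵢ − bᵢ)αᵢ₊₁ − ((αᵢ − bᵢ)αᵢ₊₁ − 1) would have |1|_p < 1.
    partial-quotient-large : ∀ i → b (suc i) ≢ 0ℚ × v (b (suc i)) ℤ.≤ ℤ.-1ℤ
    partial-quotient-large i = ¬0≤ᵥ⇒v≤-1 0≰b
      where
      0≰b : ¬ (0ℤ ≤ᵥ b (suc i))
      0≰b 0≤b with eventually⇒some (eventually-× (eventually-× (digit-close i) (digit-close (suc i))) (reciprocal i 1ℤ))
      ... | m , (xᵢ-bᵢ≥1 , xᵢ₊₁-bᵢ₊₁≥1) , eᵢ≥1 =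
        ¬1≤ᵥ1 (subst (1ℤ ≤ᵥ_) (w-[w-1]≡1 (d * X)) (≤ᵥ-minus (≤ᵥ-* xᵢ-bᵢ≥1 X≥0) eᵢ≥1))
        where
        d X : ℚ
        d = x i m - b i
        X = x (suc i) m
        w-[w-1]≡1 : ∀ w → w - (w - 1ℚ) ≡ 1ℚ
        w-[w-1]≡1 = solve 1 (λ w → w :- (w :- con 1ℚ) := con 1ℚ) refl
        X≥0 : 0ℤ ≤ᵥ X
        X≥0 = subst (0ℤ ≤ᵥ_) (a+[x-a]≡x (b (suc i)) X) (≤ᵥ-+ 0≤b (≤ᵥ-weaken (ℤ.+≤+ z≤n) xᵢ₊₁-bᵢ₊₁≥1))

    open Denominators b (proj₁ ∘ partial-quotient-large) (proj₂ ∘ partial-quotient-large)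
    open Convergents using (Palindromic; palindromic⇒Aₙ≡Bₙ₋₁)

    x-bounded : ∀ i → Bounded (x i)
    x-bounded i = v (b i) ℤ.⊓ 1ℤ , eventually-map (λ {m} xᵢ-bᵢ≥1 →
      subst (v (b i) ℤ.⊓ 1ℤ ≤ᵥ_) (a+[x-a]≡x (b i) (x i m))
        (≤ᵥ-+ (≤ᵥ-weaken (ℤₚ.i⊓j≤i (v (b i)) 1ℤ) (≤ᵥ-refl (b i))) (≤ᵥ-weaken (ℤₚ.i⊓j≤j (v (b i)) 1ℤ) xᵢ-bᵢ≥1))) (digit-close i)

    v-x : ∀ i → Eventually (λ m → x (suc i) m ≢ 0ℚ × v (x (suc i) m) ≡ v (b (suc i)))
    v-x i = eventually-map (λ {m} xᵢ₊₁-bᵢ₊₁≥1 → subst (λ z → z ≢ 0ℚ × v z ≡ v (b (suc i))) (a+[x-a]≡x (b (suc i)) (x (suc i) m))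
      (v-+-dominant (proj₁ (partial-quotient-large i)) (≤ᵥ-weaken suc[v]≤1 xᵢ₊₁-bᵢ₊₁≥1))) (digit-close (suc i))
      where
      suc[v]≤1 : ℤ.suc (v (b (suc i))) ℤ.≤ 1ℤ
      suc[v]≤1 = ℤₚ.≤-trans (ℤₚ.+-monoʳ-≤ 1ℤ (proj₂ (partial-quotient-large i))) (ℤ.+≤+ z≤n)

    -- θ j m = Bⱼ₋₂α − Aⱼ₋₂ at the m-th approximant of α, matching the shift in Ash and Bsh.
    θ : ℕ → ℕ → ℚ
    θ j m = Bsh b j * x 0 m - Ash b j

    θ-bounded : ∀ j → Bounded (θ j)
    θ-bounded j = bounded-minus (bounded-* (bounded-const (Bsh b j)) (x-bounded 0)) (bounded-const (Ash b j))

    θ-recurrence : ∀ j m → θ (suc (suc (suc j))) m ≡ b (suc j) * θ (suc (suc j)) m + θ (suc j) m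
    θ-recurrence j m = solve 6 (λ q B₂ B₁ A₂ A₁ α → (q :* B₂ :+ B₁) :* α :- (q :* A₂ :+ A₁) := q :* (B₂ :* α :- A₂) :+ (B₁ :* α :- A₁))
      refl (b (suc j)) (Bsh b (suc (suc j))) (Bsh b (suc j)) (Ash b (suc (suc j))) (Ash b (suc j)) (x 0 m)

    -- r j m → 0 is the identity (Bⱼα − Aⱼ)αⱼ₊₁ + Bⱼ₋₁α − Aⱼ₋₁ = 0, i.e.
    -- α = (Aⱼαⱼ₊₁ + Aⱼ₋₁)/(Bⱼαⱼ₊₁ + Bⱼ₋₁).
    r : ℕ → ℕ → ℚ
    r j m = θ (suc j) m + x (suc j) m * θ (suc (suc j)) m

    r₀≡e₀ : ∀ m → r 0 m ≡ e 0 m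
    r₀≡e₀ m = solve 3 (λ q α₀ α₁ → (con 0ℚ :* α₀ :- con 1ℚ) :+ α₁ :* ((q :* con 0ℚ :+ con 1ℚ) :* α₀ :- (q :* con 1ℚ :+ con 0ℚ))
                                  := (α₀ :- q) :* α₁ :- con 1ℚ) refl (b 0) (x 0 m) (x 1 m)

    r-suc : ∀ j m → r (suc j) m ≡ x (suc (suc j)) m * r j m - θ (suc (suc j)) m * e (suc j) m
    r-suc j m = begin
      θ₂ + X₂ * θ (suc (suc (suc j))) m     ≡⟨ cong (λ t → θ₂ + X₂ * t) (θ-recurrence j m) ⟩
      θ₂ + X₂ * (q * θ₂ + θ₁)               ≡⟨ solve 5 (λ q θ₁ θ₂ X₁ X₂ → θ₂ :+ X₂ :* (q :* θ₂ :+ θ₁)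
                                                 := X₂ :* (θ₁ :+ X₁ :* θ₂) :- θ₂ :* ((X₁ :- q) :* X₂ :- con 1ℚ)) refl q θ₁ θ₂ X₁ X₂ ⟩
      X₂ * (θ₁ + X₁ * θ₂) - θ₂ * ((X₁ - q) * X₂ - 1ℚ) ∎
      where
      open ≡-Reasoning
      q θ₁ θ₂ X₁ X₂ : ℚ
      q = b (suc j)
      θ₁ = θ (suc j) m
      θ₂ = θ (suc (suc j)) m
      X₁ = x (suc j) m
      X₂ = x (suc (suc j)) m

    r-null : ∀ j → Null (r j)
    r-null zero = null-resp-≗ (sym ∘ r₀≡e₀) (reciprocal 0)
    r-null (suc j) = null-resp-≗ (sym ∘ r-suc j)
      (null-minus (bounded-*-null (x-bounded (suc (suc j))) (r-null j))
              (bounded-*-null (θ-bounded (suc (suc j))) (reciprocal (suc j))))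

    θ-bound : ∀ j → Eventually (λ m → ℤ.- v (Bₙ b j) ≤ᵥ θ (suc j) m)
    θ-bound zero = 0 , λ m _ → subst₂ _≤ᵥ_ v[1]≡-v[B₀] (θ₁≡-1 m) (≤ᵥ-neg (≤ᵥ-refl 1ℚ))
      where
      v[1]≡-v[B₀] : v 1ℚ ≡ ℤ.- v (Bₙ b 0)
      v[1]≡-v[B₀] = trans v-1 (sym (trans (cong (ℤ.-_ ∘ v) B₀≡1) (cong ℤ.-_ v-1)))
      θ₁≡-1 : ∀ m → - 1ℚ ≡ θ 1 m
      θ₁≡-1 m = solve 1 (λ α → :- con 1ℚ := con 0ℚ :* α :- con 1ℚ) refl (x 0 m)
    θ-bound (suc j) = eventually-map step (eventually-× (eventually-× (θ-bound j) (r-null j (ℤ.- v (Bₙ b j)))) (v-x j))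
      where
      step : ∀ {m} → (ℤ.- v (Bₙ b j) ≤ᵥ θ (suc j) m × ℤ.- v (Bₙ b j) ≤ᵥ r j m) ×
                     (x (suc j) m ≢ 0ℚ × v (x (suc j) m) ≡ v (b (suc j))) →
             ℤ.- v (Bₙ b (suc j)) ≤ᵥ θ (suc (suc j)) m
      step {m} ((θ≥ , r≥) , (X≢0 , vX≡vb)) =
        subst (_≤ᵥ θ (suc (suc j)) m) bound≡ (≤ᵥ-cancelˡ-* X≢0 (subst (_ ≤ᵥ_) r-θ≡Xθ (≤ᵥ-minus r≥ θ≥)))
        where
        r-θ≡Xθ : r j m - θ (suc j) m ≡ x (suc j) m * θ (suc (suc j)) m
        r-θ≡Xθ = solve 2 (λ t u → t :+ u :- t := u) refl (θ (suc j) m) (x (suc j) m * θ (suc (suc j)) m)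
        regroup : ∀ a w → ℤ.- w ℤ.- a ≡ ℤ.- (a ℤ.+ w)
        regroup = solve-∀
        bound≡ : ℤ.- v (Bₙ b j) ℤ.- v (x (suc j) m) ≡ ℤ.- v (Bₙ b (suc j))
        bound≡ = trans (cong (λ a → ℤ.- v (Bₙ b j) ℤ.- a) vX≡vb)
                       (trans (regroup (v (b (suc j))) (v (Bₙ b j))) (cong ℤ.-_ (sym (v-Bₙ₊₁ j))))

    square-error : b 0 ≡ 0ℚ → ∀ n → Palindromic b n → ∀ m →
      x 0 m * x 0 m - Aₙ₋₁ b n * inv (Bₙ b n) ≡ (θ (suc n) m + x 0 m * θ (suc (suc n)) m) * inv (Bₙ b n)
    square-error b₀≡0 n palindromic m = sym (begin
      ((B₁ * α - A₁) + α * (B * α - Aₙ b n)) * inv B   ≡⟨ cong (λ A → ((B₁ * α - A₁) + α * (B * α - A)) * inv B)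
                                                            (palindromic⇒Aₙ≡Bₙ₋₁ b n b₀≡0 palindromic) ⟩
      ((B₁ * α - A₁) + α * (B * α - B₁)) * inv B      ≡⟨ solve 5 (λ α A₁ B₁ B iB → ((B₁ :* α :- A₁) :+ α :* (B :* α :- B₁)) :* iB
                                                             := α :* α :* (B :* iB) :- A₁ :* iB) refl α A₁ B₁ B (inv B) ⟩
      α * α * (B * inv B) - A₁ * inv B                 ≡⟨ cong (λ u → α * α * u - A₁ * inv B) (inv-inverseʳ (Bₙ≢0 n)) ⟩
      α * α * 1ℚ - A₁ * inv B                          ≡⟨ cong (_- A₁ * inv B) (ℚₚ.*-identityʳ (α * α)) ⟩
      α * α - A₁ * inv B                               ∎)
      where
      open ≡-Reasoning
      α A₁ B₁ B : ℚ
      α = x 0 m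
      A₁ = Aₙ₋₁ b n
      B₁ = Bsh b (suc n)
      B = Bₙ b n

    -v[Bₙ]≤1-v[Bₙ₊₁] : ∀ n → ℤ.- v (Bₙ b n) ℤ.≤ 1ℤ ℤ.+ ℤ.- v (Bₙ b (suc n))
    -v[Bₙ]≤1-v[Bₙ₊₁] n = subst (λ w → ℤ.- v (Bₙ b n) ℤ.≤ 1ℤ ℤ.+ ℤ.- w) (sym (v-Bₙ₊₁ n))
      (ℤₚ.≤-trans (ℤₚ.≤-reflexive (shift (v (Bₙ b n))))
        (ℤₚ.+-monoʳ-≤ 1ℤ (ℤₚ.neg-mono-≤ (ℤₚ.+-monoˡ-≤ (v (Bₙ b n)) v[bₙ₊₁]≤1))))
      where
      shift : ∀ w → ℤ.- w ≡ 1ℤ ℤ.+ ℤ.- (1ℤ ℤ.+ w)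
      shift = solve-∀
      v[bₙ₊₁]≤1 : v (b (suc n)) ℤ.≤ 1ℤ
      v[bₙ₊₁]≤1 = ℤₚ.≤-trans (proj₂ (partial-quotient-large n)) (ℤ.-≤+ {0} {1})

    square-error-numerator : b 0 ≡ 0ℚ → ∀ n →
      Eventually (λ m → ℤ.- v (Bₙ b n) ≤ᵥ θ (suc n) m + x 0 m * θ (suc (suc n)) m)
    square-error-numerator b₀≡0 n =
      eventually-map (λ {m} ((θ₁≥ , θ₂≥) , x₀-b₀≥1) → ≤ᵥ-+ θ₁≥ (≤ᵥ-weaken (-v[Bₙ]≤1-v[Bₙ₊₁] n) (≤ᵥ-* (x₀≥1 x₀-b₀≥1) θ₂≥)))
        (eventually-× (eventually-× (θ-bound n) (θ-bound (suc n))) (digit-close 0))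
      where
      x₀≥1 : ∀ {m} → 1ℤ ≤ᵥ x 0 m - b 0 → 1ℤ ≤ᵥ x 0 m
      x₀≥1 {m} = subst (1ℤ ≤ᵥ_) (ℚₚ.+-identityʳ (x 0 m)) ∘ subst (λ q → 1ℤ ≤ᵥ x 0 m - q) b₀≡0

    approximation : b 0 ≡ 0ℚ → ∀ n → Palindromic b n →
      LimAbsLt p (λ m → x 0 m * x 0 m - Aₙ₋₁ b n * inv (Bₙ b n))
        (pAbs p (b 1) * (pAbsRecip p (Bₙ b n) * pAbsRecip p (Bₙ b n)))
    approximation b₀≡0 n palindromic = eventually-map
      (λ {m} S≥ → subst₂ _<_ (cong (pAbs p) (sym (square-error b₀≡0 n palindromic m))) (sym rhs≡)
                    (≤ᵥ⇒pAbs< exponent< (≤ᵥ-* S≥ inv[B]≥)))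
      (square-error-numerator b₀≡0 n)
      where
      B : ℚ
      B = Bₙ b n
      inv[B]≥ : ℤ.- v B ≤ᵥ inv B
      inv[B]≥ = subst (_≤ᵥ inv B) (v-inv (Bₙ≢0 n)) (≤ᵥ-refl (inv B))
      exponent< : ℤ.- (ℤ.- v B ℤ.+ ℤ.- v B) ℤ.< ℤ.- v (b 1) ℤ.+ (v B ℤ.+ v B)
      exponent< = subst₂ ℤ._<_ (trans (ℤₚ.+-identityˡ (v B ℤ.+ v B)) (sym (neg-neg-sum (v B)))) refl
        (ℤₚ.+-monoˡ-< (v B ℤ.+ v B) (ℤₚ.suc[i]≤j⇒i<j {i = 0ℤ} (ℤₚ.neg-mono-≤ (proj₂ (partial-quotient-large 0)))))
        where
        neg-neg-sum : ∀ w → ℤ.- (ℤ.- w ℤ.+ ℤ.- w) ≡ w ℤ.+ w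
        neg-neg-sum = solve-∀
      rhs≡ : pAbs p (b 1) * (pAbsRecip p B * pAbsRecip p B) ≡ pPow p (ℤ.- v (b 1) ℤ.+ (v B ℤ.+ v B))
      rhs≡ = sym (trans (pPow-+ (ℤ.- v (b 1)) (v B ℤ.+ v B))
        (cong₂ _*_ (sym (pAbs-≢0 (proj₁ (partial-quotient-large 0)))) (pPow-+ (v B) (v B))))

open import Data.Nat using (_≤_)
open import Data.Rational using (ℚ; 0ℚ; _*_; _-_)

mainTheorem3 : (t : CFType) (p : ℕ) → Prime p → ¬ (2 ∣ p) →
    (α : ℕ → Qp p) (b : ℕ → ℚ) →
    IsCFExpansion t p α b →
    b 0 ≡ 0ℚ →
    (∀ (N : ℕ) → ∃[ n ] (N ≤ n × (∀ j → 1 ≤ j → j ≤ n → b j ≡ b (suc n ∸ j)))) →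
    ∀ (N : ℕ) → ∃[ n ] (N ≤ n ×
      LimAbsLt p (λ m → seq (α 0) m * seq (α 0) m - Aₙ₋₁ b n * inv (Bₙ b n))
        (pAbs p (b 1) * (pAbsRecip p (Bₙ b n) * pAbsRecip p (Bₙ b n))))
mainTheorem3 _ 0 ()
mainTheorem3 _ 1 ()
mainTheorem3 _ (suc (suc k)) p-prime _ α b (digits , reciprocals) b₀≡0 palindromes N with palindromes N
... | n , N≤n , palindromic = n , N≤n , approximation b₀≡0 n palindromic
  where
  open PAdic k p-prime
  open Expansion b (seq ∘ α) (λ i → eventually-map (pAbs<pPow⇒≤ᵥ 0ℤ) (proj₂ (digits i))) (λ i → limZero⇒null (reciprocals i))
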